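{- Let $[\mathcal E]\in K^0_T(X_E)$ have simple Chern roots, with rank $\operatorname{rk}(\mathcal E)$, and let $u$ be a formal variable. Then \[ \sum_{i\ge0}\zeta_{X_E}([\textstyle\bigwedge^i\mathcal E])u^i=(u+1)^{\operatorname{rk}(\mathcal E)}c\big(\mathcal E,\tfrac{u}{u+1}\big),\qquad \sum_{i\ge0}\zeta_{X_E}([\textstyle\bigwedge^i\mathcal E^\vee])u^i=(u+1)^{\operatorname{rk}(\mathcal E)}c(\mathcal E)^{ -1}c\big(\mathcal E,\tfrac1{u+1}\big). \] Equivalently, $\sum_{i\ge0}\zeta_{X_E}([\bigwedge^{\operatorname{rk}(\mathcal E)-i}\mathcal E])u^i=(u+1)^{\operatorname{rk}(\mathcal E)}c(\mathcal E,\frac1{u+1})$ and $\sum_{i\ge0}\zeta_{X_E}([\bigwedge^{\operatorname{rk}(\mathcal E)-i}\mathcal E^\vee])u^i=(u+1)^{\operatorname{rk}(\mathcal E)}c(\mathcal E)^{ -1}c(\mathcal E,\frac u{u+1})$.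
   Context: $E=\{0,\dots,n\}$, $T=(\mathbb C^*)^E$, $X_E$ the permutohedral variety with fixed points $p_\sigma$ indexed by permutations; $K^0_T(X_E)$ is identified with tuples $([\mathcal E]_\sigma)\in\prod_\sigma\mathbb Z[T_0^{\pm1},\dots,T_n^{\pm1}]$ (piecewise Laurent polynomials on the braid fan) and $A^\bullet_T(X_E)$ with piecewise polynomials in $t_0,\dots,t_n$. For $[\mathcal E]_\sigma=\sum_i a_{\sigma,i}\mathbf T^{\mathbf m_{\sigma,i}}$ ($a=\pm1$): $\operatorname{rk}(\mathcal E)=\sum_i a_{\sigma,i}$, $\sum_j[\bigwedge^j\mathcal E]_\sigma u^j=\prod_i(1+\mathbf T^{\mathbf m_{\sigma,i}}u)^{a_{\sigma,i}}$, $c^T(\mathcal E,u)_\sigma=\prod_i(1+(\mathbf m_{\sigma,i}\cdot\mathbf t)u)^{a_{\sigma,i}}$, and $c(\mathcal E,u)$, $c(\mathcal E)=c(\mathcal E,1)$ are the non-equivariant images. $[\mathcal E]$ has simple Chern roots if for each $\sigma$ there is $\mathbf m_\sigma\in\mathbb Z^E_{\ge0}$ with $[\mathcal E]_\sigma=\sum_i m_{\sigma,i}T_i$. $\zeta_{X_E}:K^0(X_E)\to A^\bullet(X_E)$ is the ring isomorphism induced by the map $K^0_T(X_E)\to A^\bullet_T(X_E)[\prod_i(1+t_i)^{ -1}]$, $f(T_0,\dots,T_n)\mapsto f(t_0+1,\dots,t_n+1)$, on the non-equivariant quotients. -}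

module Defs where

open import Level using (0ℓ)
open import Data.Nat using (ℕ; zero; suc)
open import Data.Integer using (ℤ; +_; -[1+_])
open import Data.Fin using (Fin; inject₁)
open import Data.Vec using (Vec; lookup; _[_]≔_)
open import Data.Vec.Membership.Propositional using (_∈_)
open import Data.Product using (Σ; ∃; _×_; _,_; proj₁; proj₂)
open import Algebra.Bundles using (CommutativeRing)

infixl 6 _⊕_
infixl 7 _⊗_
infix 8 ⊖_

data Poly (V : Set) : Set where
  var : V → Poly V
  con : ℤ → Poly V
  _⊕_ : Poly V → Poly V → Poly V
  _⊗_ : Poly V → Poly V → Poly V
  ⊖_  : Poly V → Poly V

module _ {V : Set} where

  infixr 9 _^P_

  1P 0P : Poly V
  1P = con (+ 1)
  0P = con (+ 0)

  _^P_ : Poly V → ℕ → Poly V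
  p ^P zero  = 1P
  p ^P suc k = p ⊗ (p ^P k)

  sumP : ∀ {k} → (Fin k → Poly V) → Poly V
  sumP {zero}  f = 0P
  sumP {suc k} f = f Data.Fin.zero ⊕ sumP (λ i → f (Data.Fin.suc i))

  prodP : ∀ {k} → (Fin k → Poly V) → Poly V
  prodP {zero}  f = 1P
  prodP {suc k} f = f Data.Fin.zero ⊗ prodP (λ i → f (Data.Fin.suc i))

module Eval (R : CommutativeRing 0ℓ 0ℓ) where
  open CommutativeRing R

  natR : ℕ → Carrier
  natR zero    = 0#
  natR (suc k) = 1# + natR k

  intR : ℤ → Carrier
  intR (+ k)     = natR k
  intR -[1+ k ]  = - natR (suc k)

  ⟦_⟧ : ∀ {V : Set} → Poly V → (V → Carrier) → Carrier
  ⟦ var x ⟧ ρ = ρ x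
  ⟦ con c ⟧ ρ = intR c
  ⟦ p ⊕ q ⟧ ρ = ⟦ p ⟧ ρ + ⟦ q ⟧ ρ
  ⟦ p ⊗ q ⟧ ρ = ⟦ p ⟧ ρ * ⟦ q ⟧ ρ
  ⟦ ⊖ p ⟧ ρ   = - ⟦ p ⟧ ρ

-- Equality in the polynomial ring ℤ[V] (free commutative ring on V):
-- equal evaluations in every commutative ring under every assignment.
infix 4 _≈P_
_≈P_ : ∀ {V : Set} → Poly V → Poly V → Set₁
_≈P_ {V} p q = (R : CommutativeRing 0ℓ 0ℓ) (ρ : V → CommutativeRing.Carrier R) →
  CommutativeRing._≈_ R (Eval.⟦_⟧ R p ρ) (Eval.⟦_⟧ R q ρ)

-- Variables. E = {0,…,n} is indexed by Fin (suc n).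

data LVar (n : ℕ) : Set where
  T   : Fin (suc n) → LVar n
  T⁻¹ : Fin (suc n) → LVar n
  uK  : LVar n

-- Equality in the Laurent polynomial ring ℤ[T_i^{±1}][u]:
-- evaluations agree whenever T_i⁻¹ is interpreted as the inverse of T_i.
infix 4 _≈L_
_≈L_ : ∀ {n} → Poly (LVar n) → Poly (LVar n) → Set₁
_≈L_ {n} p q = (R : CommutativeRing 0ℓ 0ℓ) (ρ : LVar n → CommutativeRing.Carrier R) →
  (∀ i → CommutativeRing._≈_ R (CommutativeRing._*_ R (ρ (T i)) (ρ (T⁻¹ i)))
                                (CommutativeRing.1# R)) →
  CommutativeRing._≈_ R (Eval.⟦_⟧ R p ρ) (Eval.⟦_⟧ R q ρ)

data CVar (n : ℕ) : Set where
  t : Fin (suc n) → CVar n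
  u : CVar n

-- Fixed points p_σ: a permutation σ of E written as the vector
-- (σ(0),…,σ(n)); its maximal cone of the braid fan is
-- x_{σ(0)} ≥ … ≥ x_{σ(n)}.  Tuples indexed by fixed points are functions
-- on such vectors (values on non-permutations are irrelevant).

Perm : ℕ → Set
Perm n = Vec (Fin (suc n)) (suc n)

IsPerm : ∀ {n} → Perm n → Set
IsPerm {n} σ = ∀ (i : Fin (suc n)) → i ∈ σ

-- swap the entries at positions k and k+1 (adjacent cone across a wall)
swapAdj : ∀ {A : Set} {n} → Fin n → Vec A (suc n) → Vec A (suc n)
swapAdj k σ = (σ [ inject₁ k ]≔ lookup σ (Data.Fin.suc k)) [ Data.Fin.suc k ]≔ lookup σ (inject₁ k)

-- Piecewise polynomials on the braid fan (coefficients may involve u):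
-- across the wall between σ and its adjacent σ', with wall x_a = x_b,
-- f_σ − f_σ' is divisible by t_a − t_b.
PiecewiseA : ∀ {n} → (Perm n → Poly (CVar n)) → Set₁
PiecewiseA {n} f = ∀ (σ : Perm n) → IsPerm σ → ∀ (k : Fin n) →
  ∃ λ (q : Poly (CVar n)) →
    f σ ⊕ ⊖ f (swapAdj k σ)
      ≈P (var (t (lookup σ (inject₁ k))) ⊕ ⊖ var (t (lookup σ (Data.Fin.suc k)))) ⊗ q

-- Piecewise Laurent polynomials (elements of K^0_T(X_E)):
-- f_σ − f_σ' divisible by 1 − T_a T_b⁻¹.
PiecewiseK : ∀ {n} → (Perm n → Poly (LVar n)) → Set₁
PiecewiseK {n} f = ∀ (σ : Perm n) → IsPerm σ → ∀ (k : Fin n) →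
  ∃ λ (q : Poly (LVar n)) →
    f σ ⊕ ⊖ f (swapAdj k σ)
      ≈L (1P ⊕ ⊖ (var (T (lookup σ (inject₁ k))) ⊗ var (T⁻¹ (lookup σ (Data.Fin.suc k))))) ⊗ q

-- The ideal (t_0,…,t_n)·A_T(X_E)[u]; A^•(X_E)[u] is the quotient by it.
InIdeal : ∀ {n} → (Perm n → Poly (CVar n)) → Set₁
InIdeal {n} f = Σ (Fin (suc n) → Perm n → Poly (CVar n)) λ h →
  (∀ i → PiecewiseA (h i)) ×
  (∀ (σ : Perm n) → IsPerm σ → f σ ≈P sumP (λ i → var (t i) ⊗ h i σ))

-- All denominators occurring
-- below are products of (1+t_i), (1+u) and c(E); these are
-- non-zero-divisors in A^•(X_E)[u], so A^•(X_E)[u] localized at them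
-- embeds in A^•(X_E)[[u]] and equality is cross-multiplication mod the ideal.

Fr : Set → Set
Fr V = Poly V × Poly V

module _ {V : Set} where
  infixl 6 _+F_
  infixl 7 _*F_

  ιF : Poly V → Fr V
  ιF p = p , 1P

  _+F_ : Fr V → Fr V → Fr V
  (a , b) +F (c , d) = a ⊗ d ⊕ c ⊗ b , b ⊗ d

  _*F_ : Fr V → Fr V → Fr V
  (a , b) *F (c , d) = a ⊗ c , b ⊗ d

  -F_ : Fr V → Fr V
  -F (a , b) = ⊖ a , b

  invF : Fr V → Fr V
  invF (a , b) = b , a

  _^F_ : Fr V → ℕ → Fr V
  x ^F zero  = ιF 1P
  x ^F suc k = x *F (x ^F k)

  prodF : ∀ {k} → (Fin k → Fr V) → Fr V
  prodF {zero}  f = ιF 1P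
  prodF {suc k} f = f Data.Fin.zero *F prodF (λ i → f (Data.Fin.suc i))

infix 4 _≈A_
_≈A_ : ∀ {n} → (Perm n → Fr (CVar n)) → (Perm n → Fr (CVar n)) → Set₁
F ≈A G = InIdeal (λ σ → proj₁ (F σ) ⊗ proj₂ (G σ) ⊕ ⊖ (proj₁ (G σ) ⊗ proj₂ (F σ)))

ζ : ∀ {n} → Poly (LVar n) → Fr (CVar n)
ζ (var (T i))   = ιF (1P ⊕ var (t i))
ζ (var (T⁻¹ i)) = invF (ιF (1P ⊕ var (t i)))
ζ (var uK)      = ιF (var u)
ζ (con c)       = ιF (con c)
ζ (p ⊕ q)       = ζ p +F ζ q
ζ (p ⊗ q)       = ζ p *F ζ q
ζ (⊖ p)         = -F ζ p

-- Classes with simple Chern roots: [E]_σ = Σ_i m_{σ,i} T_i.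

Mult : ℕ → Set
Mult n = Perm n → Fin (suc n) → ℕ

classE : ∀ {n} → Mult n → Perm n → Poly (LVar n)
classE m σ = sumP (λ i → con (+ m σ i) ⊗ var (T i))

IsKClass : ∀ {n} → Mult n → Set₁
IsKClass m = PiecewiseK (classE m)

sumN : ∀ {k} → (Fin k → ℕ) → ℕ
sumN {zero}  f = 0
sumN {suc k} f = f Data.Fin.zero Data.Nat.+ sumN (λ i → f (Data.Fin.suc i))

rk : ∀ {n} → Mult n → Perm n → ℕ
rk m σ = sumN (m σ)

-- Σ_j [⋀^j F]_σ u^j = ∏_i (1 + M_i u)^{mult_i}, for a class whose
-- σ-component is Σ_i mult_i M_i (M_i monomials).
wedgeGen : ∀ {n} → (Fin (suc n) → ℕ) → (Fin (suc n) → Poly (LVar n)) → Poly (LVar n)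
wedgeGen mult M = prodP (λ i → (1P ⊕ M i ⊗ var uK) ^P mult i)

-- Σ_j [⋀^j E]_σ u^j  and  Σ_j [⋀^j E^∨]_σ u^j   ([E^∨]_σ = Σ_i m_{σ,i} T_i⁻¹)
wedgeE wedgeEdual : ∀ {n} → Mult n → Perm n → Poly (LVar n)
wedgeE     m σ = wedgeGen (m σ) (λ i → var (T i))
wedgeEdual m σ = wedgeGen (m σ) (λ i → var (T⁻¹ i))

-- non-equivariant Chern polynomial c(E, x)_σ = ∏_i (1 + t_i x)^{m_{σ,i}}
-- (x a fraction in u); c(E) = c(E,1).
chern : ∀ {n} → Mult n → Perm n → Fr (CVar n) → Fr (CVar n)
chern m σ x = prodF (λ i → (ιF 1P +F ιF (var (t i)) *F x) ^F m σ i)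

1+u : ∀ {n} → Fr (CVar n)
1+u = ιF (1P ⊕ var u)

-- With simple Chern roots, Σ_j [⋀^j E]_σ u^j = ∏_i (1 + T_i u)^{m_{σ,i}}, and ζ substitutes 1 + t_i
-- for T_i.  Each factor 1 + (1 + t_i) u splits off a factor 1 + u and leaves the Chern factor
-- 1 + t_i u/(1+u) (dually for E^∨), and the split-off factors multiply to (1+u)^{rk E}.  So both
-- identities hold at every fixed point already as identities of fractions of polynomials, and the
-- witness for membership in the ideal (t_0,…,t_n) is zero.
module Submission where

open import Level using (0ℓ) renaming (suc to lsuc)
open import Data.Nat using (ℕ; zero; suc; _+_)
open import Data.Fin using (Fin)
import Data.Fin as Fin
open import Data.Product using (_×_; _,_; proj₁; proj₂)
open import Function using (_∘_)
open import Relation.Binary.PropositionalEquality using (_≡_)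
open import Relation.Binary.Bundles using (Setoid)
import Relation.Binary.PropositionalEquality as ≡
open import Algebra.Bundles using (CommutativeRing; CommutativeMonoid)
open import Algebra.Structures using (IsCommutativeMonoid)
import Algebra.Properties.CommutativeMonoid.Mult as MultProperties
import Algebra.Properties.CommutativeMonoid.Sum as SumProperties
import Algebra.Properties.CommutativeSemigroup as SemigroupProperties
import Algebra.Solver.Ring.NaturalCoefficients.Default as NaturalCoefficientsSolver
import Relation.Binary.Reasoning.Setoid as SetoidReasoning

open import Defs

-- _≈P_ unfolds to a Π-type, so Agda cannot recover its arguments by unification; this
-- record (like _≃F_ and _≐F_ below) keeps them visible.
record _≃P_ {V : Set} (p q : Poly V) : Set₁ where
  constructor ⟨_⟩
  field ≃P⇒≈P : p ≈P q
open _≃P_ public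

infix 4 _≃P_

⊗-isCommutativeMonoid : (V : Set) → IsCommutativeMonoid (_≃P_ {V}) _⊗_ 1P
⊗-isCommutativeMonoid V = record
  { isMonoid = record
    { isSemigroup = record
      { isMagma = record
        { isEquivalence = record
          { refl  = ⟨ (λ R ρ → CommutativeRing.refl R) ⟩
          ; sym   = λ p≃q → ⟨ (λ R ρ → CommutativeRing.sym R (≃P⇒≈P p≃q R ρ)) ⟩
          ; trans = λ p≃q q≃r →
              ⟨ (λ R ρ → CommutativeRing.trans R (≃P⇒≈P p≃q R ρ) (≃P⇒≈P q≃r R ρ)) ⟩
          }
        ; ∙-cong = λ p≃p′ q≃q′ →
            ⟨ (λ R ρ → CommutativeRing.*-cong R (≃P⇒≈P p≃p′ R ρ) (≃P⇒≈P q≃q′ R ρ)) ⟩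
        }
      ; assoc = λ _ _ _ → ⟨ (λ R ρ → CommutativeRing.*-assoc R _ _ _) ⟩
      }
    ; identity = (λ _ → ⟨ (λ R ρ → let open CommutativeRing R in
                    trans (*-congʳ (+-identityʳ 1#)) (*-identityˡ _)) ⟩)
               , (λ _ → ⟨ (λ R ρ → let open CommutativeRing R in
                    trans (*-congˡ (+-identityʳ 1#)) (*-identityʳ _)) ⟩)
    }
  ; comm = λ _ _ → ⟨ (λ R ρ → CommutativeRing.*-comm R _ _) ⟩
  }

⊗-commutativeMonoid : Set → CommutativeMonoid 0ℓ (lsuc 0ℓ)
⊗-commutativeMonoid V = record { isCommutativeMonoid = ⊗-isCommutativeMonoid V }

prodPowP : ∀ {V k} → (Fin k → ℕ) → (Fin k → Poly V) → Poly V
prodPowP m f = prodP (λ i → f i ^P m i)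

module _ {V : Set} where
  open CommutativeMonoid (⊗-commutativeMonoid V) public
    using () renaming (setoid to ≃P-setoid; ∙-cong to ⊗-cong)
  open CommutativeMonoid (⊗-commutativeMonoid V) using (refl; sym; trans; reflexive)
  open MultProperties (⊗-commutativeMonoid V) using (×-congʳ; ×-homo-+; ×-distrib-+)
    renaming (_×_ to _×ᴹ_)
  open SumProperties (⊗-commutativeMonoid V) using (sum; sum-cong-≋; ∑-distrib-+)
  open SemigroupProperties (CommutativeMonoid.commutativeSemigroup (⊗-commutativeMonoid V))
    using (interchange)
  open SetoidReasoning ≃P-setoid

  ^P-as-× : ∀ (p : Poly V) k → p ^P k ≡ k ×ᴹ p
  ^P-as-× p zero    = ≡.refl
  ^P-as-× p (suc k) = ≡.cong (p ⊗_) (^P-as-× p k)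

  prodP-as-sum : ∀ {k} (f : Fin k → Poly V) → prodP f ≡ sum f
  prodP-as-sum {zero}  f = ≡.refl
  prodP-as-sum {suc k} f = ≡.cong (f Fin.zero ⊗_) (prodP-as-sum (f ∘ Fin.suc))

  ^P-congˡ : ∀ {p q : Poly V} k → p ≃P q → p ^P k ≃P q ^P k
  ^P-congˡ {p} {q} k p≃q rewrite ^P-as-× p k | ^P-as-× q k = ×-congʳ k p≃q

  ^P-distribˡ-+-⊗ : ∀ (p : Poly V) j k → p ^P (j + k) ≃P p ^P j ⊗ p ^P k
  ^P-distribˡ-+-⊗ p j k rewrite ^P-as-× p (j + k) | ^P-as-× p j | ^P-as-× p k = ×-homo-+ p j k

  ^P-distribʳ-⊗ : ∀ (p q : Poly V) k → (p ⊗ q) ^P k ≃P p ^P k ⊗ q ^P k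
  ^P-distribʳ-⊗ p q k rewrite ^P-as-× (p ⊗ q) k | ^P-as-× p k | ^P-as-× q k = ×-distrib-+ p q k

  prodP-cong : ∀ {k} {f g : Fin k → Poly V} → (∀ i → f i ≃P g i) → prodP f ≃P prodP g
  prodP-cong {f = f} {g} f≃g rewrite prodP-as-sum f | prodP-as-sum g = sum-cong-≋ f≃g

  prodP-distrib-⊗ : ∀ {k} (f g : Fin k → Poly V) → prodP (λ i → f i ⊗ g i) ≃P prodP f ⊗ prodP g
  prodP-distrib-⊗ f g
    rewrite prodP-as-sum (λ i → f i ⊗ g i) | prodP-as-sum f | prodP-as-sum g = ∑-distrib-+ f g

  prodPowP-cong : ∀ {k} (m : Fin k → ℕ) {f g : Fin k → Poly V} → (∀ i → f i ≃P g i) →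
                  prodPowP m f ≃P prodPowP m g
  prodPowP-cong m f≃g = prodP-cong (λ i → ^P-congˡ (m i) (f≃g i))

  prodPowP-distrib-⊗ : ∀ {k} (m : Fin k → ℕ) (f g : Fin k → Poly V) →
                       prodPowP m (λ i → f i ⊗ g i) ≃P prodPowP m f ⊗ prodPowP m g
  prodPowP-distrib-⊗ m f g = begin
    prodP (λ i → (f i ⊗ g i) ^P m i)          ≈⟨ prodP-cong (λ i → ^P-distribʳ-⊗ (f i) (g i) (m i)) ⟩
    prodP (λ i → f i ^P m i ⊗ g i ^P m i)     ≈⟨ prodP-distrib-⊗ _ _ ⟩
    prodPowP m f ⊗ prodPowP m g               ∎

  ^P-sumN : ∀ {k} (p : Poly V) (m : Fin k → ℕ) → p ^P sumN m ≃P prodPowP m (λ _ → p)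
  ^P-sumN {zero}  p m = refl
  ^P-sumN {suc k} p m = begin
    p ^P (m Fin.zero + sumN (m ∘ Fin.suc))             ≈⟨ ^P-distribˡ-+-⊗ p (m Fin.zero) _ ⟩
    p ^P m Fin.zero ⊗ p ^P sumN (m ∘ Fin.suc)           ≈⟨ ⊗-cong refl (^P-sumN p (m ∘ Fin.suc)) ⟩
    p ^P m Fin.zero ⊗ prodPowP (m ∘ Fin.suc) (λ _ → p)  ∎

  prodPowF : ∀ {k} → (Fin k → ℕ) → (Fin k → Fr V) → Fr V
  prodPowF m f = prodF (λ i → f i ^F m i)

  infix 4 _≃F_ _≐F_

  record _≃F_ (x y : Fr V) : Set₁ where
    constructor mk≃F
    field cross-≃P : proj₁ x ⊗ proj₂ y ≃P proj₁ y ⊗ proj₂ x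

  record _≐F_ (x y : Fr V) : Set₁ where
    constructor mk≐F
    field
      num-≃P : proj₁ x ≃P proj₁ y
      den-≃P : proj₂ x ≃P proj₂ y

  open _≃F_ public

  *F-resp-≃F : ∀ {x y x′ y′ : Fr V} → x ≃F y → x′ ≃F y′ → x *F x′ ≃F y *F y′
  *F-resp-≃F {a , b} {c , d} {a′ , b′} {c′ , d′} (mk≃F x≃y) (mk≃F x′≃y′) = mk≃F (begin
    (a ⊗ a′) ⊗ (d ⊗ d′)   ≈⟨ interchange a a′ d d′ ⟩
    (a ⊗ d) ⊗ (a′ ⊗ d′)   ≈⟨ ⊗-cong x≃y x′≃y′ ⟩
    (c ⊗ b) ⊗ (c′ ⊗ b′)   ≈⟨ interchange c b c′ b′ ⟩
    (c ⊗ c′) ⊗ (b ⊗ b′)   ∎)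

  ^F-resp-≃F : ∀ {x y : Fr V} k → x ≃F y → x ^F k ≃F y ^F k
  ^F-resp-≃F zero    x≃y = mk≃F refl
  ^F-resp-≃F (suc k) x≃y = *F-resp-≃F x≃y (^F-resp-≃F k x≃y)

  prodPowF-resp-≃F : ∀ {k} (m : Fin k → ℕ) {f g : Fin k → Fr V} → (∀ i → f i ≃F g i) →
                     prodPowF m f ≃F prodPowF m g
  prodPowF-resp-≃F {zero}  m f≃g = mk≃F refl
  prodPowF-resp-≃F {suc k} m f≃g =
    *F-resp-≃F (^F-resp-≃F (m Fin.zero) (f≃g Fin.zero))
               (prodPowF-resp-≃F (m ∘ Fin.suc) (f≃g ∘ Fin.suc))

  ≃F-respʳ-≐F : ∀ {x y z : Fr V} → x ≃F y → y ≐F z → x ≃F z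
  ≃F-respʳ-≐F {a , b} {c , d} {e , f} (mk≃F x≃y) (mk≐F c≃e d≃f) = mk≃F (begin
    a ⊗ f   ≈⟨ ⊗-cong refl (sym d≃f) ⟩
    a ⊗ d   ≈⟨ x≃y ⟩
    c ⊗ b   ≈⟨ ⊗-cong c≃e refl ⟩
    e ⊗ b   ∎)

  ≐F-setoid : Setoid 0ℓ (lsuc 0ℓ)
  ≐F-setoid = record
    { Carrier       = Fr V
    ; _≈_           = _≐F_
    ; isEquivalence = record
      { refl  = mk≐F refl refl
      ; sym   = λ (mk≐F p≃ q≃) → mk≐F (sym p≃) (sym q≃)
      ; trans = λ (mk≐F p≃ q≃) (mk≐F p≃′ q≃′) → mk≐F (trans p≃ p≃′) (trans q≃ q≃′)
      }
    }

  *F-cong-≐F : ∀ {x y x′ y′ : Fr V} → x ≐F y → x′ ≐F y′ → x *F x′ ≐F y *F y′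
  *F-cong-≐F (mk≐F p≃ q≃) (mk≐F p≃′ q≃′) = mk≐F (⊗-cong p≃ p≃′) (⊗-cong q≃ q≃′)

  module Multiplicative (π : Fr V → Poly V) (π-*F : ∀ x y → π (x *F y) ≡ π x ⊗ π y)
                        (π-1 : π (ιF 1P) ≡ 1P) where

    π-^F : ∀ x k → π (x ^F k) ≡ π x ^P k
    π-^F x zero    = π-1
    π-^F x (suc k) = ≡.trans (π-*F x (x ^F k)) (≡.cong (π x ⊗_) (π-^F x k))

    π-prodPowF : ∀ {k} (m : Fin k → ℕ) f → π (prodPowF m f) ≡ prodPowP m (π ∘ f)
    π-prodPowF {zero}  m f = π-1
    π-prodPowF {suc k} m f = ≡.trans (π-*F _ _)
      (≡.cong₂ _⊗_ (π-^F (f Fin.zero) (m Fin.zero)) (π-prodPowF (m ∘ Fin.suc) (f ∘ Fin.suc)))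

    π-prodPowF-distrib-*F : ∀ {k} (m : Fin k → ℕ) (f g : Fin k → Fr V) →
      π (prodPowF m (λ i → f i *F g i)) ≃P π (prodPowF m f *F prodPowF m g)
    π-prodPowF-distrib-*F m f g = begin
      π (prodPowF m (λ i → f i *F g i))          ≡⟨ π-prodPowF m _ ⟩
      prodPowP m (λ i → π (f i *F g i))          ≈⟨ prodPowP-cong m (λ i → reflexive (π-*F (f i) (g i))) ⟩
      prodPowP m (λ i → π (f i) ⊗ π (g i))       ≈⟨ prodPowP-distrib-⊗ m _ _ ⟩
      prodPowP m (π ∘ f) ⊗ prodPowP m (π ∘ g)    ≡⟨ ≡.sym (≡.cong₂ _⊗_ (π-prodPowF m f) (π-prodPowF m g)) ⟩
      π (prodPowF m f) ⊗ π (prodPowF m g)        ≡⟨ ≡.sym (π-*F _ _) ⟩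
      π (prodPowF m f *F prodPowF m g)           ∎

    π-^F-sumN : ∀ {k} (m : Fin k → ℕ) x → π (x ^F sumN m) ≃P π (prodPowF m (λ _ → x))
    π-^F-sumN m x = begin
      π (x ^F sumN m)                ≡⟨ π-^F x (sumN m) ⟩
      π x ^P sumN m                  ≈⟨ ^P-sumN (π x) m ⟩
      prodPowP m (λ _ → π x)         ≡⟨ ≡.sym (π-prodPowF m _) ⟩
      π (prodPowF m (λ _ → x))       ∎

  private
    module Num = Multiplicative proj₁ (λ _ _ → ≡.refl) ≡.refl
    module Den = Multiplicative proj₂ (λ _ _ → ≡.refl) ≡.refl

  prodPowF-distrib-*F : ∀ {k} (m : Fin k → ℕ) (f g : Fin k → Fr V) →
                        prodPowF m (λ i → f i *F g i) ≐F prodPowF m f *F prodPowF m g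
  prodPowF-distrib-*F m f g =
    mk≐F (Num.π-prodPowF-distrib-*F m f g) (Den.π-prodPowF-distrib-*F m f g)

  ^F-sumN : ∀ {k} (m : Fin k → ℕ) (x : Fr V) → x ^F sumN m ≐F prodPowF m (λ _ → x)
  ^F-sumN m x = mk≐F (Num.π-^F-sumN m x) (Den.π-^F-sumN m x)

  prodPowF-*F-constˡ : ∀ {k} (m : Fin k → ℕ) (x : Fr V) (f : Fin k → Fr V) →
                       prodPowF m (λ i → x *F f i) ≐F x ^F sumN m *F prodPowF m f
  prodPowF-*F-constˡ m x f =
    ≐F.trans (prodPowF-distrib-*F m (λ _ → x) f) (*F-cong-≐F (≐F.sym (^F-sumN m x)) ≐F.refl)
    where module ≐F = Setoid ≐F-setoid

  invF-^F : ∀ (x : Fr V) k → invF (x ^F k) ≡ invF x ^F k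
  invF-^F x zero    = ≡.refl
  invF-^F x (suc k) = ≡.cong (invF x *F_) (invF-^F x k)

  invF-prodPowF : ∀ {k} (m : Fin k → ℕ) (f : Fin k → Fr V) →
                  invF (prodPowF m f) ≡ prodPowF m (invF ∘ f)
  invF-prodPowF {zero}  m f = ≡.refl
  invF-prodPowF {suc k} m f =
    ≡.cong₂ _*F_ (invF-^F (f Fin.zero) (m Fin.zero)) (invF-prodPowF (m ∘ Fin.suc) (f ∘ Fin.suc))

ζ-^P : ∀ {n} (p : Poly (LVar n)) k → ζ (p ^P k) ≡ ζ p ^F k
ζ-^P p zero    = ≡.refl
ζ-^P p (suc k) = ≡.cong (ζ p *F_) (ζ-^P p k)

ζ-prodPowP : ∀ {n k} (m : Fin k → ℕ) (f : Fin k → Poly (LVar n)) →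
             ζ (prodPowP m f) ≡ prodPowF m (ζ ∘ f)
ζ-prodPowP {k = zero}  m f = ≡.refl
ζ-prodPowP {k = suc k} m f =
  ≡.cong₂ _*F_ (ζ-^P (f Fin.zero) (m Fin.zero)) (ζ-prodPowP (m ∘ Fin.suc) (f ∘ Fin.suc))

chernFactor : ∀ {n} → Fr (CVar n) → Fin (suc n) → Fr (CVar n)
chernFactor x i = ιF 1P +F ιF (var (t i)) *F x

-- The fraction arithmetic of Defs in the syntax of the semiring solver, chosen so that a
-- transcribed identity is definitionally its evaluated ≃F goal; in particular ⟦ 1P ⟧ is
-- 1# + 0#, not 1#.
module Transcription (R : CommutativeRing 0ℓ 0ℓ) where
  open CommutativeRing R using (commutativeSemiring)
  open NaturalCoefficientsSolver commutativeSemiring using (Polynomial; _:*_; _:=_; con)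
  open NaturalCoefficientsSolver commutativeSemiring public using (solve; _:+_)

  infixl 6 _+S_
  infixl 7 _*S_
  infix  4 _≃S_

  FrS : Set
  FrS = Polynomial 2 × Polynomial 2

  𝟙 : Polynomial 2
  𝟙 = con 1 :+ con 0

  ι : Polynomial 2 → FrS
  ι p = p , 𝟙

  _+S_ _*S_ : FrS → FrS → FrS
  (a , b) +S (c , d) = a :* d :+ c :* b , b :* d
  (a , b) *S (c , d) = a :* c , b :* d

  invS : FrS → FrS
  invS (a , b) = b , a

  _≃S_ : FrS → FrS → Polynomial 2 × Polynomial 2
  (a , b) ≃S (c , d) = a :* d := c :* b

ζ-1+Tu : ∀ {n} (i : Fin (suc n)) →
         ζ (1P ⊕ var (T i) ⊗ var uK) ≃F 1+u *F chernFactor (ιF (var u) *F invF 1+u) i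
ζ-1+Tu i = mk≃F ⟨ (λ R ρ → let open Transcription R in
  solve 2 (λ τ υ → ι 𝟙 +S ι (𝟙 :+ τ) *S ι υ
                   ≃S ι (𝟙 :+ υ) *S (ι 𝟙 +S ι τ *S (ι υ *S invS (ι (𝟙 :+ υ)))))
          (CommutativeRing.refl R) (ρ (t i)) (ρ u)) ⟩

ζ-1+T⁻¹u : ∀ {n} (i : Fin (suc n)) →
           ζ (1P ⊕ var (T⁻¹ i) ⊗ var uK)
             ≃F 1+u *F invF (chernFactor (ιF 1P) i) *F chernFactor (invF 1+u) i
ζ-1+T⁻¹u i = mk≃F ⟨ (λ R ρ → let open Transcription R in
  solve 2 (λ τ υ → ι 𝟙 +S invS (ι (𝟙 :+ τ)) *S ι υ
                   ≃S ι (𝟙 :+ υ) *S invS (ι 𝟙 +S ι τ *S ι 𝟙) *S (ι 𝟙 +S ι τ *S invS (ι (𝟙 :+ υ))))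
          (CommutativeRing.refl R) (ρ (t i)) (ρ u)) ⟩

ζ-wedge-chern : ∀ {n} (mult : Fin (suc n) → ℕ) →
  ζ (wedgeGen mult (λ i → var (T i)))
    ≃F 1+u ^F sumN mult *F prodPowF mult (chernFactor (ιF (var u) *F invF 1+u))
ζ-wedge-chern mult rewrite ζ-prodPowP mult (λ i → 1P ⊕ var (T i) ⊗ var uK) =
    ≃F-respʳ-≐F (prodPowF-resp-≃F mult ζ-1+Tu) (prodPowF-*F-constˡ mult 1+u cᵤ)
  where cᵤ = chernFactor (ιF (var u) *F invF 1+u)

ζ-wedgeDual-chern : ∀ {n} (mult : Fin (suc n) → ℕ) →
  ζ (wedgeGen mult (λ i → var (T⁻¹ i)))
    ≃F 1+u ^F sumN mult *F invF (prodPowF mult (chernFactor (ιF 1P)))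
         *F prodPowF mult (chernFactor (invF 1+u))
ζ-wedgeDual-chern mult rewrite ζ-prodPowP mult (λ i → 1P ⊕ var (T⁻¹ i) ⊗ var uK) =
    ≃F-respʳ-≐F (prodPowF-resp-≃F mult ζ-1+T⁻¹u) regroup
  where
  open SetoidReasoning ≐F-setoid
  open Setoid ≐F-setoid using (refl)
  c₁ = chernFactor (ιF 1P)
  cᵤ = chernFactor (invF 1+u)
  regroup : prodPowF mult (λ i → 1+u *F invF (c₁ i) *F cᵤ i)
              ≐F 1+u ^F sumN mult *F invF (prodPowF mult c₁) *F prodPowF mult cᵤ
  regroup = begin
    prodPowF mult (λ i → 1+u *F invF (c₁ i) *F cᵤ i)
      ≈⟨ prodPowF-distrib-*F mult (λ i → 1+u *F invF (c₁ i)) cᵤ ⟩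
    prodPowF mult (λ i → 1+u *F invF (c₁ i)) *F prodPowF mult cᵤ
      ≈⟨ *F-cong-≐F (prodPowF-*F-constˡ mult 1+u (invF ∘ c₁)) refl ⟩
    1+u ^F sumN mult *F prodPowF mult (invF ∘ c₁) *F prodPowF mult cᵤ
      ≡⟨ ≡.cong (λ d → 1+u ^F sumN mult *F d *F prodPowF mult cᵤ) (≡.sym (invF-prodPowF mult c₁)) ⟩
    1+u ^F sumN mult *F invF (prodPowF mult c₁) *F prodPowF mult cᵤ
      ∎

sumP-zeroʳ : ∀ {V k} (f : Fin k → Poly V) → sumP (λ i → f i ⊗ 0P) ≈P 0P
sumP-zeroʳ {k = zero}  f R ρ = CommutativeRing.refl R
sumP-zeroʳ {k = suc k} f R ρ = let open CommutativeRing R in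
  trans (+-cong (zeroʳ _) (sumP-zeroʳ (f ∘ Fin.suc) R ρ)) (+-identityʳ 0#)

0P-piecewise : ∀ {n} → PiecewiseA {n} (λ _ → 0P)
0P-piecewise σ _ k = 0P , λ R ρ → let open CommutativeRing R in trans (-‿inverseʳ _) (sym (zeroʳ _))

≈A-from-≃F : ∀ {n} {F G : Perm n → Fr (CVar n)} → (∀ σ → F σ ≃F G σ) → F ≈A G
≈A-from-≃F F≃G = (λ _ _ → 0P) , (λ _ → 0P-piecewise) , λ σ _ R ρ →
  let open CommutativeRing R in
  trans (trans (+-cong (≃P⇒≈P (cross-≃P (F≃G σ)) R ρ) refl) (-‿inverseʳ _))
        (sym (sumP-zeroʳ (var ∘ t) R ρ))

proposition10p5 : (n : ℕ) (m : Mult n) → IsKClass m →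
    ((λ σ → ζ (wedgeE m σ))
       ≈A (λ σ → (1+u ^F rk m σ) *F chern m σ (ιF (var u) *F invF 1+u)))
    × ((λ σ → ζ (wedgeEdual m σ))
       ≈A (λ σ → (1+u ^F rk m σ) *F invF (chern m σ (ιF 1P)) *F chern m σ (invF 1+u)))
proposition10p5 n m _ =
  ≈A-from-≃F (λ σ → ζ-wedge-chern (m σ)) , ≈A-from-≃F (λ σ → ζ-wedgeDual-chern (m σ))
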